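{- Let $S$ be a Foulis semigroup and $s\in S$ a self-adjoint idempotent ($s^\dagger=s=s\cdot s$). Then $\mathrm{End}(s)=\{t\in S: s\cdot t=t=t\cdot s\}$ is a Foulis semigroup with multiplication the multiplication of $S$, unit $s$, involution $\dagger$, and operation $[t]_s=s\cdot[t]\cdot s$. For $s=1$ this gives $\mathrm{End}(1)=S$ with its original structure.
   Context: A Foulis semigroup is a monoid $(S,\cdot,1)$ with maps $(-)^\dagger\colon S\to S$ and $[-]\colon S\to S$ such that: (1) $1^\dagger=1$, $(s\cdot t)^\dagger=t^\dagger\cdot s^\dagger$, $s^{\dagger\dagger}=s$; (2) $[s]\cdot[s]=[s]=[s]^\dagger$; (3) $0:=[1]$ satisfies $0\cdot s=0=s\cdot0$; (4) $s\cdot x=0$ iff there is $y$ with $x=[s]\cdot y$. -}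

module Defs where

open import Level using (Level; _⊔_; suc)
open import Algebra.Core using (Op₁; Op₂)
open import Algebra.Structures using (IsMonoid)
open import Data.Product using (Σ; ∃; _×_; _,_; proj₁; proj₂)
open import Relation.Binary.Core using (Rel)
import Relation.Binary.Reasoning.Setoid as SetoidReasoning

record IsFoulisSemigroup {a ℓ} {A : Set a} (_≈_ : Rel A ℓ)
         (_∙_ : Op₂ A) (ε : A) (_† : Op₁ A) ([_] : Op₁ A) : Set (a ⊔ ℓ) where
  field
    isMonoid  : IsMonoid _≈_ _∙_ ε
    †-cong    : ∀ {x y} → x ≈ y → (x †) ≈ (y †)
    []-cong   : ∀ {x y} → x ≈ y → [ x ] ≈ [ y ]
    ε-†       : (ε †) ≈ ε
    †-antihom : ∀ s t → ((s ∙ t) †) ≈ ((t †) ∙ (s †))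
    †-invol   : ∀ s → ((s †) †) ≈ s
    []-idem   : ∀ s → ([ s ] ∙ [ s ]) ≈ [ s ]
    []-selfadj : ∀ s → ([ s ] †) ≈ [ s ]
    -- (3) 0 := [1] is a zero
    zeroˡ     : ∀ s → ([ ε ] ∙ s) ≈ [ ε ]
    zeroʳ     : ∀ s → (s ∙ [ ε ]) ≈ [ ε ]
    foulis⇒   : ∀ s x → (s ∙ x) ≈ [ ε ] → ∃ λ y → x ≈ ([ s ] ∙ y)
    foulis⇐   : ∀ s x → (∃ λ y → x ≈ ([ s ] ∙ y)) → (s ∙ x) ≈ [ ε ]

record FoulisSemigroup c ℓ : Set (suc (c ⊔ ℓ)) where
  infixl 7 _∙_
  infix 4 _≈_
  field
    Carrier : Set c
    _≈_     : Rel Carrier ℓ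
    _∙_     : Op₂ Carrier
    ε       : Carrier
    _†      : Op₁ Carrier
    [_]     : Op₁ Carrier
    isFoulisSemigroup : IsFoulisSemigroup _≈_ _∙_ ε _† [_]
  open IsFoulisSemigroup isFoulisSemigroup public
  open IsMonoid isMonoid public using (setoid; assoc; ∙-cong; identityˡ; identityʳ; refl; sym; trans)

module End {c ℓ} (S : FoulisSemigroup c ℓ) (s : FoulisSemigroup.Carrier S)
           (s†≈s : FoulisSemigroup._≈_ S (FoulisSemigroup._† S s) s)
           (ss≈s : FoulisSemigroup._≈_ S (FoulisSemigroup._∙_ S s s) s) where
  open FoulisSemigroup S
  open SetoidReasoning setoid

  InEnd : Carrier → Set ℓ
  InEnd t = (s ∙ t ≈ t) × (t ∙ s ≈ t)

  Carrierₛ : Set (c ⊔ ℓ)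
  Carrierₛ = Σ Carrier InEnd

  _≈ₛ_ : Rel Carrierₛ ℓ
  x ≈ₛ y = proj₁ x ≈ proj₁ y

  _∙ₛ_ : Op₂ Carrierₛ
  (t , st , ts) ∙ₛ (u , su , us) = t ∙ u ,
    (begin s ∙ (t ∙ u) ≈⟨ sym (assoc s t u) ⟩ (s ∙ t) ∙ u ≈⟨ ∙-cong st refl ⟩ t ∙ u ∎) ,
    (begin (t ∙ u) ∙ s ≈⟨ assoc t u s ⟩ t ∙ (u ∙ s) ≈⟨ ∙-cong refl us ⟩ t ∙ u ∎)

  εₛ : Carrierₛ
  εₛ = s , ss≈s , ss≈s

  _†ₛ : Op₁ Carrierₛ
  (t , st , ts) †ₛ = t † ,
    (begin s ∙ (t †)      ≈⟨ ∙-cong (sym s†≈s) refl ⟩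
           (s †) ∙ (t †)  ≈⟨ sym (†-antihom t s) ⟩
           (t ∙ s) †      ≈⟨ †-cong ts ⟩
           t † ∎) ,
    (begin (t †) ∙ s      ≈⟨ ∙-cong refl (sym s†≈s) ⟩
           (t †) ∙ (s †)  ≈⟨ sym (†-antihom s t) ⟩
           (s ∙ t) †      ≈⟨ †-cong st ⟩
           t † ∎)

  [_]ₛ : Op₁ Carrierₛ
  [ (t , _) ]ₛ = s ∙ [ t ] ∙ s ,
    (begin s ∙ (s ∙ [ t ] ∙ s) ≈⟨ sym (assoc s (s ∙ [ t ]) s) ⟩
           s ∙ (s ∙ [ t ]) ∙ s ≈⟨ ∙-cong (sym (assoc s s [ t ])) refl ⟩
           s ∙ s ∙ [ t ] ∙ s   ≈⟨ ∙-cong (∙-cong ss≈s refl) refl ⟩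
           s ∙ [ t ] ∙ s ∎) ,
    (begin s ∙ [ t ] ∙ s ∙ s   ≈⟨ assoc (s ∙ [ t ]) s s ⟩
           s ∙ [ t ] ∙ (s ∙ s) ≈⟨ ∙-cong refl ss≈s ⟩
           s ∙ [ t ] ∙ s ∎)

module Submission where

-- Everything rests on two general consequences of the Foulis property (4),
-- writing 0 = [1]:
--   * self-annihilation  t ∙ [t] ≈ 0     (take y = 1 in (4), direction ⇐);
--   * absorption         t ∙ x ≈ 0  ⇒  [t] ∙ x ≈ x   (by (4) ⇒ and [t] idempotent).
-- Inside the corner the Foulis operation is [t]ₛ = s ∙ [t] ∙ s.  Its zero is
-- [s]ₛ = s ∙ [s] ∙ s ≈ 0, an element t of End(s) still annihilates [t]ₛ, and
-- [t]ₛ fixes every x ∈ End(s) annihilated by t.  These three corner facts give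
-- idempotency of [t]ₛ, the zero laws and both directions of the Foulis
-- property in End(s); the monoid and involution axioms are inherited from S
-- because End(s) is closed under ∙ and † and s is a two-sided unit on it.

open import Defs
open import Data.Product using (_×_; _,_; proj₁; proj₂; Σ)
open import Algebra.Structures using (IsMonoid)
import Relation.Binary.Reasoning.Setoid as SetoidReasoning

module FoulisFacts {c ℓ} (S : FoulisSemigroup c ℓ) where
  open FoulisSemigroup S
  open SetoidReasoning setoid

  0# : Carrier
  0# = [ ε ]

  -- Every element annihilates its own Foulis image: [t] = [t] ∙ 1.
  self-annihilation : ∀ t → t ∙ [ t ] ≈ 0#
  self-annihilation t = foulis⇐ t [ t ] (ε , sym (identityʳ [ t ]))

  -- [t] acts as the identity on the right annihilator of t:
  -- if x ≈ [t] ∙ y then [t] ∙ x ≈ [t] ∙ [t] ∙ y ≈ [t] ∙ y ≈ x.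
  absorption : ∀ t x → t ∙ x ≈ 0# → [ t ] ∙ x ≈ x
  absorption t x tx≈0 with foulis⇒ t x tx≈0
  ... | y , x≈[t]y = begin
    [ t ] ∙ x           ≈⟨ ∙-cong refl x≈[t]y ⟩
    [ t ] ∙ ([ t ] ∙ y) ≈⟨ sym (assoc [ t ] [ t ] y) ⟩
    [ t ] ∙ [ t ] ∙ y   ≈⟨ ∙-cong ([]-idem t) refl ⟩
    [ t ] ∙ y           ≈⟨ sym x≈[t]y ⟩
    x                   ∎

module Corner {c ℓ} (S : FoulisSemigroup c ℓ) (s : FoulisSemigroup.Carrier S)
              (s†≈s : FoulisSemigroup._≈_ S (FoulisSemigroup._† S s) s)
              (ss≈s : FoulisSemigroup._≈_ S (FoulisSemigroup._∙_ S s s) s) where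
  open FoulisSemigroup S
  open FoulisFacts S
  open End S s s†≈s ss≈s
  open SetoidReasoning setoid

  -- The Foulis zero of the corner is the zero of S: s ∙ [s] ∙ s ≈ 0 ∙ s ≈ 0.
  corner-zero : s ∙ [ s ] ∙ s ≈ 0#
  corner-zero = trans (∙-cong (self-annihilation s) refl) (zeroˡ s)

  -- An element of the corner annihilates its corner Foulis image, since t ∙ s ≈ t.
  corner-self-annihilation : ∀ t → InEnd t → t ∙ (s ∙ [ t ] ∙ s) ≈ 0#
  corner-self-annihilation t (_ , ts≈t) = begin
    t ∙ (s ∙ [ t ] ∙ s) ≈⟨ sym (assoc t (s ∙ [ t ]) s) ⟩
    t ∙ (s ∙ [ t ]) ∙ s ≈⟨ ∙-cong (sym (assoc t s [ t ])) refl ⟩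
    t ∙ s ∙ [ t ] ∙ s   ≈⟨ ∙-cong (∙-cong ts≈t refl) refl ⟩
    t ∙ [ t ] ∙ s       ≈⟨ ∙-cong (self-annihilation t) refl ⟩
    0# ∙ s              ≈⟨ zeroˡ s ⟩
    0#                  ∎

  -- Corner version of absorption: on elements x of the corner annihilated
  -- by t, the outer s's are absorbed by x and [t] fixes x.
  corner-absorption : ∀ t x → InEnd x → t ∙ x ≈ 0# → s ∙ [ t ] ∙ s ∙ x ≈ x
  corner-absorption t x (sx≈x , _) tx≈0 = begin
    s ∙ [ t ] ∙ s ∙ x   ≈⟨ assoc (s ∙ [ t ]) s x ⟩
    s ∙ [ t ] ∙ (s ∙ x) ≈⟨ ∙-cong refl sx≈x ⟩
    s ∙ [ t ] ∙ x       ≈⟨ assoc s [ t ] x ⟩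
    s ∙ ([ t ] ∙ x)     ≈⟨ ∙-cong refl (absorption t x tx≈0) ⟩
    s ∙ x               ≈⟨ sx≈x ⟩
    x                   ∎

  corner-isMonoid : IsMonoid _≈ₛ_ _∙ₛ_ εₛ
  corner-isMonoid = record
    { isSemigroup = record
      { isMagma = record
        { isEquivalence = record { refl = refl ; sym = sym ; trans = trans }
        ; ∙-cong        = ∙-cong
        }
      ; assoc = λ x y z → assoc (proj₁ x) (proj₁ y) (proj₁ z)
      }
    ; identity = (λ x → proj₁ (proj₂ x)) , (λ x → proj₂ (proj₂ x))
    }

  -- [t]ₛ is idempotent: t annihilates [t]ₛ ∈ End(s), so [t]ₛ fixes it.
  corner-[]-idem : ∀ x → ([ x ]ₛ ∙ₛ [ x ]ₛ) ≈ₛ [ x ]ₛ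
  corner-[]-idem x@(t , t∈End) =
    corner-absorption t (proj₁ [ x ]ₛ) (proj₂ [ x ]ₛ) (corner-self-annihilation t t∈End)

  corner-[]-selfadj : ∀ x → ([ x ]ₛ †ₛ) ≈ₛ [ x ]ₛ
  corner-[]-selfadj (t , _) = begin
    (s ∙ [ t ] ∙ s) †         ≈⟨ †-antihom (s ∙ [ t ]) s ⟩
    s † ∙ (s ∙ [ t ]) †       ≈⟨ ∙-cong s†≈s (†-antihom s [ t ]) ⟩
    s ∙ ([ t ] † ∙ s †)       ≈⟨ ∙-cong refl (∙-cong ([]-selfadj t) s†≈s) ⟩
    s ∙ ([ t ] ∙ s)           ≈⟨ sym (assoc s [ t ] s) ⟩
    s ∙ [ t ] ∙ s             ∎

  corner-zeroˡ : ∀ x → ([ εₛ ]ₛ ∙ₛ x) ≈ₛ [ εₛ ]ₛ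
  corner-zeroˡ (x , _) = begin
    s ∙ [ s ] ∙ s ∙ x ≈⟨ ∙-cong corner-zero refl ⟩
    0# ∙ x            ≈⟨ zeroˡ x ⟩
    0#                ≈⟨ sym corner-zero ⟩
    s ∙ [ s ] ∙ s     ∎

  corner-zeroʳ : ∀ x → (x ∙ₛ [ εₛ ]ₛ) ≈ₛ [ εₛ ]ₛ
  corner-zeroʳ (x , _) = begin
    x ∙ (s ∙ [ s ] ∙ s) ≈⟨ ∙-cong refl corner-zero ⟩
    x ∙ 0#              ≈⟨ zeroʳ x ⟩
    0#                  ≈⟨ sym corner-zero ⟩
    s ∙ [ s ] ∙ s       ∎

  -- Foulis property ⇒ in End(s): if t ∙ y ≈ 0 then y itself is the witness,
  -- since [t]ₛ fixes y.
  corner-foulis⇒ : ∀ x y → (x ∙ₛ y) ≈ₛ [ εₛ ]ₛ → Σ Carrierₛ (λ w → y ≈ₛ ([ x ]ₛ ∙ₛ w))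
  corner-foulis⇒ (t , _) y@(u , u∈End) tu≈[s]ₛ =
    y , sym (corner-absorption t u u∈End (trans tu≈[s]ₛ corner-zero))

  corner-foulis⇐ : ∀ x y → Σ Carrierₛ (λ w → y ≈ₛ ([ x ]ₛ ∙ₛ w)) → (x ∙ₛ y) ≈ₛ [ εₛ ]ₛ
  corner-foulis⇐ (t , t∈End) (u , _) ((w , _) , u≈[t]ₛw) = begin
    t ∙ u                   ≈⟨ ∙-cong refl u≈[t]ₛw ⟩
    t ∙ (s ∙ [ t ] ∙ s ∙ w) ≈⟨ sym (assoc t (s ∙ [ t ] ∙ s) w) ⟩
    t ∙ (s ∙ [ t ] ∙ s) ∙ w ≈⟨ ∙-cong (corner-self-annihilation t t∈End) refl ⟩
    0# ∙ w                  ≈⟨ zeroˡ w ⟩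
    0#                      ≈⟨ sym corner-zero ⟩
    s ∙ [ s ] ∙ s           ∎

  corner-isFoulisSemigroup : IsFoulisSemigroup _≈ₛ_ _∙ₛ_ εₛ _†ₛ [_]ₛ
  corner-isFoulisSemigroup = record
    { isMonoid   = corner-isMonoid
    ; †-cong     = †-cong
    ; []-cong    = λ t≈u → ∙-cong (∙-cong refl ([]-cong t≈u)) refl
    ; ε-†        = s†≈s
    ; †-antihom  = λ x y → †-antihom (proj₁ x) (proj₁ y)
    ; †-invol    = λ x → †-invol (proj₁ x)
    ; []-idem    = corner-[]-idem
    ; []-selfadj = corner-[]-selfadj
    ; zeroˡ      = corner-zeroˡ
    ; zeroʳ      = corner-zeroʳ
    ; foulis⇒    = corner-foulis⇒
    ; foulis⇐    = corner-foulis⇐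
    }

corollary4p5 : ∀ {c ℓ} (S : FoulisSemigroup c ℓ) →
    let open FoulisSemigroup S in
    (∀ (s : Carrier) (s†≈s : (s †) ≈ s) (ss≈s : s ∙ s ≈ s) →
      let open End S s s†≈s ss≈s in
      IsFoulisSemigroup _≈ₛ_ _∙ₛ_ εₛ _†ₛ [_]ₛ)
    × ((∀ t → End.InEnd S ε ε-† (identityˡ ε) t)
       × (∀ t → ε ∙ [ t ] ∙ ε ≈ [ t ]))
corollary4p5 S =
    Corner.corner-isFoulisSemigroup S
  , (λ t → identityˡ t , identityʳ t)
  , (λ t → trans (identityʳ (ε ∙ [ t ])) (identityˡ [ t ]))
  where open FoulisSemigroup S
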